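{- Let $\lambda/\mu$ be a skew shape with $n$ cells which is not a connected ribbon, and let $(\mathrm{cDes},p)$ be any cyclic extension of the descent map $\mathrm{Des}$ on $\mathrm{SYT}(\lambda/\mu)$. Then \[ n\, s_{\lambda/\mu}=\sum_{T\in\mathrm{SYT}(\lambda/\mu)}F^{\mathrm{cyc}}_{n,\mathrm{cDes}(T)}, \] where $s_{\lambda/\mu}$ is the skew Schur function.
   Context: A ribbon is a skew shape containing no $2\times2$ square. $\mathrm{SYT}(\lambda/\mu)$ is the set of standard Young tableaux of shape $\lambda/\mu$; for such $T$, $\mathrm{Des}(T)=\{1\le i\le n-1: i+1 \text{ appears in a lower row of } T \text{ than } i\}$. For a finite set $\mathcal T$ with a map $\mathrm{Des}:\mathcal T\to 2^{[n-1]}$ ($n>1$), a cyclic extension is a pair $(\mathrm{cDes},p)$ of a map $\mathrm{cDes}:\mathcal T\to2^{[n]}$ and a bijection $p:\mathcal T\to\mathcal T$ such that for all $T$: $\mathrm{cDes}(T)\cap[n-1]=\mathrm{Des}(T)$; $\mathrm{cDes}(p(T))=1+\mathrm{cDes}(T)$ (mod $n$); and $\varnothing\subsetneq\mathrm{cDes}(T)\subsetneq[n]$. For $J\subseteq[n]$, let $P^{\mathrm{cyc}}_{n,J}$ be the set of pairs $(w,k)$ with $w\in\{1,2,\dots\}^n$, $k\in[n]$, such that (i) $w_k\le w_{k+1}\le\cdots\le w_n\le w_1\le\cdots\le w_{k-1}$, and (ii) $w_j<w_{j+1}$ for every $j\in J\setminus\{k-1\}$, indices modulo $n$. Define $F^{\mathrm{cyc}}_{n,J}:=\sum_{(w,k)\in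 P^{\mathrm{cyc}}_{n,J}}x_{w_1}\cdots x_{w_n}$. -}

module Defs where

open import Data.Nat using (ℕ; zero; suc; _+_; _*_; _∸_; _≤_; _<_)
import Data.Nat as N
open import Data.Nat.Properties using () renaming (_≟_ to _≟ℕ_; _<?_ to _<?ℕ_)
open import Data.Nat.DivMod using (_%_; m%n<n)
open import Data.Fin as F using (Fin; toℕ; fromℕ<)
open import Data.Fin.Properties using (all?; any?) renaming (_≟_ to _≟F_)
open import Data.Fin.Subset using (Subset; _∈_; _∉_)
open import Data.Fin.Subset.Properties using (_∈?_)
open import Data.Vec as V using (Vec; []; _∷_)
open import Data.List as L using (List; []; _∷_; length; map; concatMap; upTo; filter; cartesianProduct; allFin)
open import Data.Nat.ListAction using (sum)
open import Data.Product using (Σ; ∃; ∃-syntax; _×_; _,_; proj₁; proj₂)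
open import Data.Sum using (_⊎_)
open import Data.Maybe using (Maybe; just; nothing)
open import Relation.Nullary using (¬_; Dec; yes; no)
import Relation.Nullary.Decidable
open import Relation.Nullary.Decidable using (True; fromWitness; _×-dec_; _→-dec_; ¬?)
open import Relation.Binary.PropositionalEquality using (_≡_)
open import Function.Bundles using (_⇔_)
open import Function.Definitions using (Bijective)

-- Partitions and skew shapes (English convention, rows/cols 0-based)

part : List ℕ → ℕ → ℕ
part []       _       = 0
part (x ∷ _)  zero    = x
part (_ ∷ xs) (suc i) = part xs i

-- a partition: weakly decreasing list of naturals (trailing zeros harmless)
IsPartition : List ℕ → Set
IsPartition la = ∀ i → part la (suc i) ≤ part la i

_⊆ₚ_ : List ℕ → List ℕ → Set
mu ⊆ₚ la = ∀ i → part mu i ≤ part la i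

Cell : Set
Cell = ℕ × ℕ   -- (row , column)

InShape : List ℕ → List ℕ → Cell → Set
InShape la mu (i , j) = part mu i ≤ j × j < part la i

cells : List ℕ → List ℕ → List Cell
cells la mu = concatMap rowCells (upTo (length la))
  where
  rowCells : ℕ → List Cell
  rowCells i = map (λ d → (i , part mu i + d)) (upTo (part la i ∸ part mu i))

size : List ℕ → List ℕ → ℕ
size la mu = length (cells la mu)

cellAt : (la mu : List ℕ) → Fin (size la mu) → Cell
cellAt la mu a = L.lookup (cells la mu) a

rowOf colOf : (la mu : List ℕ) → Fin (size la mu) → ℕ
rowOf la mu a = proj₁ (cellAt la mu a)
colOf la mu a = proj₂ (cellAt la mu a)

IsRibbon : List ℕ → List ℕ → Set
IsRibbon la mu = ¬ (Σ ℕ λ i → Σ ℕ λ j →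
  InShape la mu (i , j) × InShape la mu (i , suc j) ×
  InShape la mu (suc i , j) × InShape la mu (suc i , suc j))

Adjacent : Cell → Cell → Set
Adjacent (i , j) (i' , j') =
  (i ≡ i' × (suc j ≡ j' ⊎ j ≡ suc j')) ⊎ (j ≡ j' × (suc i ≡ i' ⊎ i ≡ suc i'))

data Reach (la mu : List ℕ) : Cell → Cell → Set where
  here : ∀ {c} → Reach la mu c c
  step : ∀ {c d e} → InShape la mu d → Adjacent c d → Reach la mu d e → Reach la mu c e

IsConnected : List ℕ → List ℕ → Set
IsConnected la mu = ∀ c d → InShape la mu c → InShape la mu d → Reach la mu c d

IsConnectedRibbon : List ℕ → List ℕ → Set
IsConnectedRibbon la mu = IsRibbon la mu × IsConnected la mu

-- Fillings of λ/μ : position ↦ entry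

RightOf : Cell → Cell → Set
RightOf (i , j) (i' , j') = i' ≡ i × j' ≡ suc j

Below : Cell → Cell → Set
Below (i , j) (i' , j') = i' ≡ suc i × j' ≡ j

rightOf? : ∀ c d → Dec (RightOf c d)
rightOf? (i , j) (i' , j') = (i' ≟ℕ i) ×-dec (j' ≟ℕ suc j)

below? : ∀ c d → Dec (Below c d)
below? (i , j) (i' , j') = (i' ≟ℕ suc i) ×-dec (j' ≟ℕ j)

allVecs : (m n : ℕ) → List (Vec (Fin m) n)
allVecs m zero    = [] ∷ []
allVecs m (suc n) = concatMap (λ x → map (x ∷_) (allVecs m n)) (allFin m)

occ : ∀ {m n} → Fin m → Vec (Fin m) n → ℕ
occ x w = length (filter (λ y → y ≟F x) (V.toList w))

-- content condition: letter a (variable x_{a+1}) occurs α_a times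
HasContent : (α : List ℕ) → ∀ {n} → Vec (Fin (length α)) n → Set
HasContent α w = ∀ a → occ a w ≡ L.lookup α a

hasContent? : (α : List ℕ) → ∀ {n} (w : Vec (Fin (length α)) n) → Dec (HasContent α w)
hasContent? α w = all? (λ a → occ a w ≟ℕ L.lookup α a)

IsSSYT : (la mu : List ℕ) → ∀ {m} → Vec (Fin m) (size la mu) → Set
IsSSYT la mu T =
  (∀ a b → RightOf (cellAt la mu a) (cellAt la mu b) → V.lookup T a F.≤ V.lookup T b) ×
  (∀ a b → Below (cellAt la mu a) (cellAt la mu b) → V.lookup T a F.< V.lookup T b)

isSSYT? : (la mu : List ℕ) → ∀ {m} (T : Vec (Fin m) (size la mu)) → Dec (IsSSYT la mu T)
isSSYT? la mu T =
  all? (λ a → all? (λ b → rightOf? (cellAt la mu a) (cellAt la mu b) →-dec (V.lookup T a F.≤? V.lookup T b)))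
  ×-dec
  all? (λ a → all? (λ b → below? (cellAt la mu a) (cellAt la mu b) →-dec (V.lookup T a F.<? V.lookup T b)))

-- standard Young tableau: entries 0..n-1 (standing for 1..n), each used once,
-- rows and columns strictly increasing
IsSYT : (la mu : List ℕ) → Vec (Fin (size la mu)) (size la mu) → Set
IsSYT la mu T =
  (∀ a b → V.lookup T a ≡ V.lookup T b → a ≡ b) ×
  (∀ a b → RightOf (cellAt la mu a) (cellAt la mu b) → V.lookup T a F.< V.lookup T b) ×
  (∀ a b → Below (cellAt la mu a) (cellAt la mu b) → V.lookup T a F.< V.lookup T b)

isSYT? : (la mu : List ℕ) → (T : Vec (Fin (size la mu)) (size la mu)) → Dec (IsSYT la mu T)
isSYT? la mu T =
  all? (λ a → all? (λ b → (V.lookup T a ≟F V.lookup T b) →-dec (a ≟F b)))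
  ×-dec
  all? (λ a → all? (λ b → rightOf? (cellAt la mu a) (cellAt la mu b) →-dec (V.lookup T a F.<? V.lookup T b)))
  ×-dec
  all? (λ a → all? (λ b → below? (cellAt la mu a) (cellAt la mu b) →-dec (V.lookup T a F.<? V.lookup T b)))

-- the set SYT(λ/μ) (the proof component is proof-irrelevant)
SYT : List ℕ → List ℕ → Set
SYT la mu = Σ (Vec (Fin (size la mu)) (size la mu)) (λ T → True (isSYT? la mu T))

toSYT : (la mu : List ℕ) → Vec (Fin (size la mu)) (size la mu) → Maybe (SYT la mu)
toSYT la mu T with isSYT? la mu T
... | yes p = just (T , Relation.Nullary.Decidable.fromWitness {a? = isSYT? la mu T} p)
... | no  _ = nothing

allSYT : (la mu : List ℕ) → List (SYT la mu)
allSYT la mu = L.mapMaybe (toSYT la mu) (allVecs (size la mu) (size la mu))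

-- Descent: index i : Fin n stands for the element i+1 of [n];
-- i+1 ∈ Des(T) iff the entry i+2 lies in a lower row than the entry i+1
-- (0-based entries: value suc i lies in a lower row than value i).
IsDescent : (la mu : List ℕ) → SYT la mu → Fin (size la mu) → Set
IsDescent la mu (T , _) i = ∃[ a ] ∃[ b ]
  (toℕ (V.lookup T a) ≡ toℕ i × toℕ (V.lookup T b) ≡ suc (toℕ i) × rowOf la mu a < rowOf la mu b)

-- Cyclic extensions. Subsets of [n] are `Subset n`, index i ↔ element i+1.

csuc : ∀ {n} → Fin n → Fin n
csuc {suc n} i = fromℕ< (m%n<n (suc (toℕ i)) (suc n))

record CyclicExtension (la mu : List ℕ) : Set where
  field
    cDes     : SYT la mu → Subset (size la mu)
    p        : SYT la mu → SYT la mu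
    p-bij    : Bijective _≡_ _≡_ p
    -- cDes(T) ∩ [n-1] = Des(T)
    extends  : ∀ T i → suc (toℕ i) < size la mu → (i ∈ cDes T ⇔ IsDescent la mu T i)
    rotates  : ∀ T i → (csuc i ∈ cDes (p T) ⇔ i ∈ cDes T)
    nonempty : ∀ T → ∃[ i ] (i ∈ cDes T)
    nonfull  : ∀ T → ∃[ i ] (i ∉ cDes T)

-- Formal power series in x_1, x_2, ... with ℕ coefficients, given by their
-- coefficient function: a monomial x_1^{α_0} x_2^{α_1} ... is given by the
-- finite exponent list α (trailing zeros allowed).

Series : Set
Series = List ℕ → ℕ

_≈ˢ_ : Series → Series → Set
f ≈ˢ g = ∀ α → f α ≡ g α

_·ˢ_ : ℕ → Series → Series
(k ·ˢ f) α = k * f α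

sumˢ : List Series → Series
sumˢ fs α = sum (map (λ f → f α) fs)

-- skew Schur function: coefficient of x^α = #SSYT(λ/μ) of content α
skewSchur : List ℕ → List ℕ → Series
skewSchur la mu α = length (filter (isSSYT? la mu) (filter (hasContent? α) (allVecs (length α) (size la mu))))

-- P^cyc_{n,J}, positions 0-based: position j stands for index j+1,
-- k : Fin n stands for k+1, and "j ≠ k-1 (mod n)" is "csuc j ≢ k".
InPcyc : ∀ {m n} → Subset n → Vec (Fin m) n → Fin n → Set
InPcyc J w k =
  (∀ j → ¬ (csuc j ≡ k) → V.lookup w j F.≤ V.lookup w (csuc j)) ×
  (∀ j → j ∈ J → ¬ (csuc j ≡ k) → V.lookup w j F.< V.lookup w (csuc j))

inPcyc? : ∀ {m n} (J : Subset n) (w : Vec (Fin m) n) (k : Fin n) → Dec (InPcyc J w k)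
inPcyc? J w k =
  all? (λ j → ¬? (csuc j ≟F k) →-dec (V.lookup w j F.≤? V.lookup w (csuc j)))
  ×-dec
  all? (λ j → (j ∈? J) →-dec (¬? (csuc j ≟F k) →-dec (V.lookup w j F.<? V.lookup w (csuc j))))

-- F^cyc_{n,J}: coefficient of x^α = #{(w,k) ∈ P^cyc_{n,J} : w has content α}
Fcyc : (n : ℕ) → Subset n → Series
Fcyc n J α = length (filter (λ wk → inPcyc? J (proj₁ wk) (proj₂ wk))
  (cartesianProduct (filter (hasContent? α) (allVecs (length α) n)) (allFin n)))

module Submission where

open import Defs
open import Data.List using (List; map)
open import Data.Nat using (ℕ)
open import Relation.Nullary using (¬_)

-- Fix a content α.  The coefficient of x^α in F^cyc_{n,J} counts pairs (w, k); grouping them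
-- by the cut k gives a sum over k ∈ [n].  For a fixed k, rotating words by k positions turns
-- the cyclic condition for J' into the linear condition "weakly increasing, strictly at J"
-- when J' is J rotated by k.  Since cDes(p^k T) = cDes(T) + k and p^k permutes SYT(λ/μ),
-- the k-th summand equals Σ_T #{u ascending with strict ascents at cDes(T) ∩ [n-1] = Des(T)},
-- independently of k.  By Gessel's fundamental lemma this is the number of semistandard
-- tableaux of shape λ/μ and content α: (T, u) ↦ u ∘ T is a bijection onto them, inverted by
-- standardization.  Hence the total is n times the coefficient of s_{λ/μ}.  (The hypothesis
-- that λ/μ is not a connected ribbon only guarantees that cyclic extensions exist.)


module Counting where

  open import Level using (Level)
  open import Data.Nat using (ℕ; suc; _+_; _*_; _≤_; _<_; z≤n; s≤s)
  open import Data.Nat.Properties using (m≤n⇒m≤1+n; *-zeroʳ)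
  open import Data.Nat.ListAction using (sum)
  open import Data.Nat.ListAction.Properties using (sum-↭)
  open import Data.List using (List; []; _∷_; _++_; length; map; filter; cartesianProduct)
  open import Data.List.Properties using (length-map; length-++; filter-++; map-∘)
  open import Data.List.Membership.Propositional using (_∈_)
  open import Data.List.Membership.Propositional.Properties using (∈-filter⁺; ∈-filter⁻; ∈-map⁺; ∈-map⁻)
  open import Data.List.Relation.Unary.Any using (here; there)
  open import Data.List.Relation.Unary.All as All using (All)
  open import Data.List.Relation.Unary.AllPairs using ([]; _∷_)
  import Data.List.Relation.Unary.All.Properties as AllP
  open import Data.List.Relation.Unary.Unique.Propositional using (Unique)
  open import Data.List.Relation.Unary.Unique.Propositional.Properties using (filter⁺)
  open import Data.List.Relation.Binary.Permutation.Propositional using (_↭_)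
  open import Data.List.Relation.Binary.Permutation.Propositional.Properties using (↭-length)
  import Data.List.Relation.Binary.Permutation.Propositional.Properties as Perm
  open import Data.List.Relation.Binary.BagAndSetEquality using (∼bag⇒↭)
  open import Data.List.Membership.Propositional.Properties.WithK using (unique∧set⇒bag)
  open import Data.Product using (∃-syntax; _×_; _,_)
  open import Function.Bundles using (mk⇔)
  open import Relation.Nullary using (¬_; yes; no)
  open import Relation.Unary using (Pred; Decidable; _⊆_)
  open import Relation.Binary.PropositionalEquality
    using (_≡_; refl; sym; trans; cong; cong₂; module ≡-Reasoning)
  open import Data.Empty using (⊥-elim)
  open import Data.Nat.Tactic.RingSolver using (solve-∀)

  private
    variable
      a b p q : Level
      A : Set a
      B : Set b

  unique-↭ : {xs ys : List A} → Unique xs → Unique ys →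
    (∀ {z} → z ∈ xs → z ∈ ys) → (∀ {z} → z ∈ ys → z ∈ xs) → xs ↭ ys
  unique-↭ ux uy to from = ∼bag⇒↭ (unique∧set⇒bag ux uy (mk⇔ to from))

  map-unique : (f : A → B) {xs : List A} →
    (∀ {x y} → x ∈ xs → y ∈ xs → f x ≡ f y → x ≡ y) → Unique xs → Unique (map f xs)
  map-unique f inj [] = []
  map-unique f {x ∷ xs} inj (x∉ ∷ u) =
    AllP.map⁺ (All.tabulate (λ y∈ fx≡fy → All.lookup x∉ y∈ (inj (here refl) (there y∈) fx≡fy)))
    ∷ map-unique f (λ x∈ y∈ → inj (there x∈) (there y∈)) u

  module _ {P : Pred A p} {Q : Pred B q} (P? : Decidable P) (Q? : Decidable Q) where
    count-bijection : {xs : List A} {ys : List B} → Unique xs → Unique ys → (f : A → B) →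
      (∀ {x} → x ∈ xs → P x → f x ∈ ys × Q (f x)) →
      (∀ {x y} → x ∈ xs → y ∈ xs → P x → P y → f x ≡ f y → x ≡ y) →
      (∀ {y} → y ∈ ys → Q y → ∃[ x ] (x ∈ xs × P x × f x ≡ y)) →
      length (filter P? xs) ≡ length (filter Q? ys)
    count-bijection {xs} {ys} ux uy f into inj onto =
      trans (sym (length-map f (filter P? xs))) (↭-length (unique-↭ image-unique (filter⁺ Q? uy) to from))
      where
      image-unique : Unique (map f (filter P? xs))
      image-unique = map-unique f (λ x∈ y∈ →
        let (x∈xs , px) = ∈-filter⁻ P? x∈ ; (y∈xs , py) = ∈-filter⁻ P? y∈ in inj x∈xs y∈xs px py)
        (filter⁺ P? ux)
      to : ∀ {z} → z ∈ map f (filter P? xs) → z ∈ filter Q? ys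
      to z∈ with ∈-map⁻ f z∈
      ... | x , x∈ , refl with ∈-filter⁻ P? x∈
      ... | x∈xs , px = let (fx∈ , qfx) = into x∈xs px in ∈-filter⁺ Q? fx∈ qfx
      from : ∀ {z} → z ∈ filter Q? ys → z ∈ map f (filter P? xs)
      from z∈ with ∈-filter⁻ Q? z∈
      ... | z∈ys , qz with onto z∈ys qz
      ... | x , x∈xs , px , refl = ∈-map⁺ f (∈-filter⁺ P? x∈xs px)

  module _ {P : Pred A p} {Q : Pred A q} (P? : Decidable P) (Q? : Decidable Q) (P⊆Q : P ⊆ Q) where
    filter-length-mono : ∀ xs → length (filter P? xs) ≤ length (filter Q? xs)
    filter-length-mono [] = z≤n
    filter-length-mono (x ∷ xs) with P? x | Q? x
    ... | yes _  | yes _  = s≤s (filter-length-mono xs)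
    ... | yes px | no ¬qx = ⊥-elim (¬qx (P⊆Q px))
    ... | no _   | yes _  = m≤n⇒m≤1+n (filter-length-mono xs)
    ... | no _   | no _   = filter-length-mono xs

    filter-length-strict : ∀ {xs y} → y ∈ xs → Q y → ¬ P y → length (filter P? xs) < length (filter Q? xs)
    filter-length-strict {x ∷ xs} (here refl) qy ¬py with P? x | Q? x
    ... | yes py | _      = ⊥-elim (¬py py)
    ... | no _   | yes _  = s≤s (filter-length-mono xs)
    ... | no _   | no ¬qy = ⊥-elim (¬qy qy)
    filter-length-strict {x ∷ xs} (there y∈) qy ¬py with P? x | Q? x
    ... | yes _  | yes _  = s≤s (filter-length-strict y∈ qy ¬py)
    ... | yes px | no ¬qx = ⊥-elim (¬qx (P⊆Q px))
    ... | no _   | yes _  = m≤n⇒m≤1+n (filter-length-strict y∈ qy ¬py)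
    ... | no _   | no _   = filter-length-strict y∈ qy ¬py

  module _ {P : Pred B p} (P? : Decidable P) (f : A → B) where
    length-filter-map : ∀ xs → length (filter P? (map f xs)) ≡ length (filter (λ x → P? (f x)) xs)
    length-filter-map [] = refl
    length-filter-map (x ∷ xs) with P? (f x)
    ... | yes _ = cong suc (length-filter-map xs)
    ... | no _  = length-filter-map xs

  module _ {P : Pred (A × B) p} (P? : Decidable P) where
    count-pairs : ∀ (xs : List A) (ys : List B) →
      length (filter P? (cartesianProduct xs ys)) ≡ sum (map (λ x → length (filter (λ y → P? (x , y)) ys)) xs)
    count-pairs [] ys = refl
    count-pairs (x ∷ xs) ys = begin
      length (filter P? (map (x ,_) ys ++ cartesianProduct xs ys))
        ≡⟨ cong length (filter-++ P? (map (x ,_) ys) (cartesianProduct xs ys)) ⟩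
      length (filter P? (map (x ,_) ys) ++ filter P? (cartesianProduct xs ys))
        ≡⟨ length-++ (filter P? (map (x ,_) ys)) ⟩
      length (filter P? (map (x ,_) ys)) + length (filter P? (cartesianProduct xs ys))
        ≡⟨ cong₂ _+_ (length-filter-map P? (x ,_) ys) (count-pairs xs ys) ⟩
      length (filter (λ y → P? (x , y)) ys) + sum (map (λ x → length (filter (λ y → P? (x , y)) ys)) xs) ∎
      where open ≡-Reasoning

  sum-map-+ : (f g : A → ℕ) (xs : List A) → sum (map (λ x → f x + g x) xs) ≡ sum (map f xs) + sum (map g xs)
  sum-map-+ f g [] = refl
  sum-map-+ f g (x ∷ xs) rewrite sum-map-+ f g xs = +-interchange (f x) (g x) (sum (map f xs)) (sum (map g xs))
    where
    +-interchange : ∀ a b c d → a + b + (c + d) ≡ a + c + (b + d)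
    +-interchange = solve-∀

  sum-map-const : (c : ℕ) (xs : List A) → sum (map (λ _ → c) xs) ≡ length xs * c
  sum-map-const c [] = refl
  sum-map-const c (x ∷ xs) = cong (c +_) (sum-map-const c xs)

  sum-swap : (f : A → B → ℕ) (xs : List A) (ys : List B) →
    sum (map (λ x → sum (map (f x) ys)) xs) ≡ sum (map (λ y → sum (map (λ x → f x y) xs)) ys)
  sum-swap f [] ys = sym (trans (sum-map-const 0 ys) (*-zeroʳ (length ys)))
  sum-swap f (x ∷ xs) ys = trans (cong (sum (map (f x) ys) +_) (sum-swap f xs ys))
    (sym (sum-map-+ (f x) (λ y → sum (map (λ x → f x y) xs)) ys))

  sum-reindex : {xs : List A} → Unique xs → (π : A → A) → (∀ {x y} → π x ≡ π y → x ≡ y) →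
    (∀ {x} → x ∈ xs → π x ∈ xs) → (∀ {y} → y ∈ xs → ∃[ x ] (x ∈ xs × π x ≡ y)) →
    (c : A → ℕ) → sum (map (λ x → c (π x)) xs) ≡ sum (map c xs)
  sum-reindex {xs = xs} ux π inj into onto c =
    trans (cong sum (map-∘ {g = c} {f = π} xs))
          (sum-↭ (Perm.map⁺ c (unique-↭ (map-unique π (λ _ _ → inj) ux) ux to from)))
    where
    to : ∀ {z} → z ∈ map π xs → z ∈ xs
    to z∈ with ∈-map⁻ π z∈
    ... | x , x∈ , refl = into x∈
    from : ∀ {z} → z ∈ xs → z ∈ map π xs
    from z∈ with onto z∈
    ... | x , x∈ , refl = ∈-map⁺ π x∈

module Enumeration where

  open Counting
  open import Data.Nat using (ℕ; zero; suc)
  open import Data.Fin as F using (Fin)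
  open import Data.Vec as V using (Vec; []; _∷_)
  open import Data.List as L using (List; []; _∷_; length; map; filter; concatMap; mapMaybe)
  open import Data.List.Membership.Propositional using (_∈_)
  open import Data.List.Membership.Propositional.Properties
    using (∈-filter⁺; ∈-filter⁻; ∈-map⁺; ∈-map⁻; ∈-concat⁺′; ∈-concat⁻′; ∈-allFin)
  open import Data.List.Relation.Unary.Any using (here; there; index)
  open import Data.List.Relation.Unary.All as All using (All)
  open import Data.List.Relation.Unary.AllPairs using ([]; _∷_)
  open import Data.List.Relation.Unary.Unique.Propositional using (Unique)
  open import Data.List.Relation.Unary.Unique.Propositional.Properties using (++⁺; allFin⁺; filter⁺)
  open import Data.Maybe using (Maybe; just; nothing)
  open import Data.Product using (∃-syntax; _×_; _,_; proj₁; proj₂)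
  open import Data.Empty using (⊥-elim)
  open import Function using (_∘_)
  open import Relation.Nullary using (¬_; Dec; yes; no)
  open import Relation.Nullary.Decidable using (True; toWitness)
  open import Relation.Binary.PropositionalEquality using (_≡_; _≢_; refl; sym; trans; cong)

  module _ {a b} {A : Set a} {B : Set b} (f : A → List B) (key : B → A)
           (key-spec : ∀ {x y} → y ∈ f x → key y ≡ x) (f-unique : ∀ x → Unique (f x)) where
    concatMap-unique : ∀ {xs} → Unique xs → Unique (concatMap f xs)
    concatMap-unique [] = []
    concatMap-unique {x ∷ xs} (x∉ ∷ u) = ++⁺ (f-unique x) (concatMap-unique u) disjoint
      where
      disjoint : ∀ {v} → ¬ (v ∈ f x × v ∈ concatMap f xs)
      disjoint (v∈fx , v∈rest) with ∈-concat⁻′ (map f xs) v∈rest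
      ... | ys , v∈ys , ys∈ with ∈-map⁻ f ys∈
      ... | x' , x'∈ , refl = All.lookup x∉ x'∈ (trans (sym (key-spec v∈fx)) (key-spec v∈ys))

  allVecs-unique : ∀ m n → Unique (allVecs m n)
  allVecs-unique m zero = All.[] ∷ []
  allVecs-unique m (suc n) = concatMap-unique (λ x → map (x ∷_) (allVecs m n)) V.head head-spec
    (λ x → map-unique (x ∷_) (λ { _ _ refl → refl }) (allVecs-unique m n)) (allFin⁺ m)
    where
    head-spec : ∀ {x} {w : Vec (Fin m) (suc n)} → w ∈ map (x ∷_) (allVecs m n) → V.head w ≡ x
    head-spec w∈ with ∈-map⁻ _ w∈
    ... | _ , _ , refl = refl

  allVecs-complete : ∀ {m n} (w : Vec (Fin m) n) → w ∈ allVecs m n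
  allVecs-complete [] = here refl
  allVecs-complete {m} {suc n} (x ∷ w) =
    ∈-concat⁺′ (∈-map⁺ (x ∷_) (allVecs-complete w)) (∈-map⁺ (λ x → map (x ∷_) (allVecs m n)) (∈-allFin x))

  Words : (α : List ℕ) (n : ℕ) → List (Vec (Fin (length α)) n)
  Words α n = filter (hasContent? α) (allVecs (length α) n)

  words-unique : ∀ α n → Unique (Words α n)
  words-unique α n = filter⁺ (hasContent? α) (allVecs-unique (length α) n)

  ∈-words⁺ : ∀ {α n} (w : Vec (Fin (length α)) n) → HasContent α w → w ∈ Words α n
  ∈-words⁺ {α} w = ∈-filter⁺ (hasContent? α) (allVecs-complete w)

  ∈-words⁻ : ∀ {α n} {w : Vec (Fin (length α)) n} → w ∈ Words α n → HasContent α w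
  ∈-words⁻ {α} {n} = proj₂ ∘ ∈-filter⁻ (hasContent? α) {xs = allVecs (length α) n}

  module _ {a b} {A : Set a} {B : Set b} (f : A → Maybe B) where
    ∈-mapMaybe⁺ : ∀ {xs x y} → x ∈ xs → f x ≡ just y → y ∈ mapMaybe f xs
    ∈-mapMaybe⁺ {x ∷ xs} (here refl) eq with f x
    ∈-mapMaybe⁺ {x ∷ xs} (here refl) refl | just _ = here refl
    ∈-mapMaybe⁺ {x ∷ xs} (there x∈) eq with f x
    ... | just _  = there (∈-mapMaybe⁺ x∈ eq)
    ... | nothing = ∈-mapMaybe⁺ x∈ eq

    ∈-mapMaybe⁻ : ∀ {xs y} → y ∈ mapMaybe f xs → ∃[ x ] (x ∈ xs × f x ≡ just y)
    ∈-mapMaybe⁻ {x ∷ xs} y∈ with f x in eq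
    ∈-mapMaybe⁻ {x ∷ xs} (here refl) | just _ = x , here refl , eq
    ∈-mapMaybe⁻ {x ∷ xs} (there y∈)  | just _ with ∈-mapMaybe⁻ y∈
    ... | x' , x'∈ , e = x' , there x'∈ , e
    ∈-mapMaybe⁻ {x ∷ xs} y∈ | nothing with ∈-mapMaybe⁻ y∈
    ... | x' , x'∈ , e = x' , there x'∈ , e

    mapMaybe-unique : ∀ {xs} → Unique xs → (∀ {x x' y} → f x ≡ just y → f x' ≡ just y → x ≡ x') →
      Unique (mapMaybe f xs)
    mapMaybe-unique [] inj = []
    mapMaybe-unique {x ∷ xs} (x∉ ∷ u) inj with f x in eq
    ... | nothing = mapMaybe-unique u inj
    ... | just z  = All.tabulate fresh ∷ mapMaybe-unique u inj
      where
      fresh : ∀ {w} → w ∈ mapMaybe f xs → z ≢ w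
      fresh w∈ refl with ∈-mapMaybe⁻ w∈
      ... | x' , x'∈ , e = All.lookup x∉ x'∈ (inj eq e)

  SYT-≡ : ∀ {la mu} (S S' : SYT la mu) → proj₁ S ≡ proj₁ S' → S ≡ S'
  SYT-≡ {la} {mu} (T , t) (.T , t') refl = cong (T ,_) (True-irrelevant (isSYT? la mu T) t t')
    where
    True-irrelevant : ∀ {p} {P : Set p} (d : Dec P) (x y : True d) → x ≡ y
    True-irrelevant (yes _) _ _ = refl

  toSYT-entries : ∀ la mu T {S} → toSYT la mu T ≡ just S → proj₁ S ≡ T
  toSYT-entries la mu T eq with isSYT? la mu T
  toSYT-entries la mu T refl | yes _ = refl

  toSYT-defined : ∀ la mu T → IsSYT la mu T → ∃[ S ] toSYT la mu T ≡ just S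
  toSYT-defined la mu T p with isSYT? la mu T
  ... | yes _ = _ , refl
  ... | no ¬p = ⊥-elim (¬p p)

  toSYT-self : ∀ la mu (S : SYT la mu) → toSYT la mu (proj₁ S) ≡ just S
  toSYT-self la mu (T , t) = agree (toSYT-defined la mu T (toWitness {a? = isSYT? la mu T} t))
    where
    agree : ∃[ S ] toSYT la mu T ≡ just S → toSYT la mu T ≡ just (T , t)
    agree (S , eq) = trans eq (cong just (SYT-≡ {la} {mu} S (T , t) (toSYT-entries la mu T eq)))

  allSYT-unique : ∀ la mu → Unique (allSYT la mu)
  allSYT-unique la mu = mapMaybe-unique (toSYT la mu) (allVecs-unique _ _)
    (λ {x} {x'} e e' → trans (sym (toSYT-entries la mu x e)) (toSYT-entries la mu x' e'))

  allSYT-complete : ∀ la mu (S : SYT la mu) → S ∈ allSYT la mu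
  allSYT-complete la mu S = ∈-mapMaybe⁺ (toSYT la mu) (allVecs-complete (proj₁ S)) (toSYT-self la mu S)

module FiniteWords where

  open Counting
  open import Data.Nat using (ℕ; zero; suc; _<_; _≤_; _<?_; s≤s)
  open import Data.Nat.Properties
    using (<-irrefl; <-trans; n<1+n; suc-injective; ≤-antisym; ≮⇒≥; 1+n≢0; <-≤-trans; <⇒≤pred)
  open import Data.Nat.DivMod using (_%_; m≤n⇒m%n≡m; n%n≡0)
  open import Data.Fin as F using (Fin; toℕ; fromℕ<; punchOut)
  open import Data.Fin.Properties
    using (all?; any?; toℕ-injective; toℕ-fromℕ<; toℕ<n; punchOut-injective; injective⇒≤)
    renaming (_≟_ to _≟F_)
  open import Data.Fin.Subset using (Subset; _∈_)
  open import Data.Fin.Subset.Properties using (_∈?_)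
  open import Data.Vec as V using (Vec)
  open import Data.Vec.Properties using (lookup∘tabulate; tabulate∘lookup; tabulate-cong)
  open import Data.List as L using ([]; _∷_; length; filter; allFin)
  open import Data.List.Properties using (map-tabulate; filter-≐; filter-all; length-upTo)
  open import Data.List.Membership.Propositional.Properties using (∈-allFin; ∈-upTo⁺; ∈-upTo⁻)
  open import Data.List.Relation.Unary.All as All using (All)
  open import Data.List.Relation.Unary.Unique.Propositional.Properties using (allFin⁺; upTo⁺)
  open import Data.Product using (∃-syntax; _×_; _,_)
  open import Data.Empty using (⊥-elim)
  open import Relation.Nullary using (¬_; Dec; yes; no)
  open import Relation.Unary using (_≐_)
  open import Relation.Nullary.Decidable using (_×-dec_; _→-dec_)
  open import Relation.Binary.PropositionalEquality
    using (_≡_; _≢_; refl; sym; trans; cong; subst; module ≡-Reasoning)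

  vec-ext : ∀ {a} {A : Set a} {n} (v w : Vec A n) → (∀ i → V.lookup v i ≡ V.lookup w i) → v ≡ w
  vec-ext v w h = trans (sym (tabulate∘lookup v)) (trans (tabulate-cong h) (tabulate∘lookup w))

  injective⇒surjective : ∀ {n} (f : Fin n → Fin n) → (∀ {i j} → f i ≡ f j → i ≡ j) → ∀ y → ∃[ x ] f x ≡ y
  injective⇒surjective {suc n} f inj y with any? (λ x → f x ≟F y)
  ... | yes hit = hit
  ... | no miss = ⊥-elim (<-irrefl refl (injective⇒≤ {f = squeeze} squeeze-injective))
    where
    avoids : ∀ i → y ≢ f i
    avoids i eq = miss (i , sym eq)
    squeeze : Fin (suc n) → Fin n
    squeeze i = punchOut (avoids i)
    squeeze-injective : ∀ {i j} → squeeze i ≡ squeeze j → i ≡ j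
    squeeze-injective {i} {j} eq = inj (punchOut-injective (avoids i) (avoids j) eq)

  count-below : ∀ n m → m ≤ n → length (filter (λ (i : Fin n) → toℕ i <? m) (allFin n)) ≡ m
  count-below n m m≤n = trans
    (count-bijection (λ (i : Fin n) → toℕ i <? m) (_<? m) (allFin⁺ n) (upTo⁺ m) toℕ
      (λ _ i<m → ∈-upTo⁺ i<m , i<m)
      (λ _ _ _ _ → toℕ-injective)
      (λ {k} k∈ k<m → fromℕ< (<-≤-trans k<m m≤n) , ∈-allFin _ ,
         subst (_< m) (sym (toℕ-fromℕ< _)) k<m , toℕ-fromℕ< _))
    (trans (cong length (filter-all (_<? m) (All.tabulate ∈-upTo⁻))) (length-upTo m))

  occ-positions : ∀ {m n} (x : Fin m) (w : Vec (Fin m) n) →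
    occ x w ≡ length (filter (λ i → V.lookup w i ≟F x) (allFin n))
  occ-positions {m} {n} x w = trans
    (cong (λ l → length (filter (λ y → y ≟F x) l))
          (trans (toList-tabulate w) (sym (map-tabulate (λ i → i) (V.lookup w)))))
    (length-filter-map (λ y → y ≟F x) (V.lookup w) (allFin n))
    where
    toList-tabulate : ∀ {k} (v : Vec (Fin m) k) → V.toList v ≡ L.tabulate (V.lookup v)
    toList-tabulate V.[] = refl
    toList-tabulate (y V.∷ v) = cong (y ∷_) (toList-tabulate v)

  occ-permute : ∀ {m n} (x : Fin m) (w : Vec (Fin m) n) (σ : Fin n → Fin n) → (∀ {i j} → σ i ≡ σ j → i ≡ j) →
    occ x (V.tabulate (λ i → V.lookup w (σ i))) ≡ occ x w
  occ-permute {n = n} x w σ σ-inj = begin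
    occ x wσ                                                    ≡⟨ occ-positions x wσ ⟩
    length (filter (λ i → V.lookup wσ i ≟F x) (allFin n))        ≡⟨ cong length (filter-≐ _ _ entries (allFin n)) ⟩
    length (filter (λ i → V.lookup w (σ i) ≟F x) (allFin n))     ≡⟨ reindex ⟩
    length (filter (λ i → V.lookup w i ≟F x) (allFin n))         ≡⟨ sym (occ-positions x w) ⟩
    occ x w                                                     ∎
    where
    open ≡-Reasoning
    wσ : Vec _ n
    wσ = V.tabulate (λ i → V.lookup w (σ i))
    entries : (λ i → V.lookup wσ i ≡ x) ≐ (λ i → V.lookup w (σ i) ≡ x)
    entries = (λ {i} e → trans (sym (lookup∘tabulate _ i)) e) , (λ {i} e → trans (lookup∘tabulate _ i) e)
    reindex : length (filter (λ i → V.lookup w (σ i) ≟F x) (allFin n)) ≡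
              length (filter (λ i → V.lookup w i ≟F x) (allFin n))
    reindex = count-bijection (λ i → V.lookup w (σ i) ≟F x) (λ i → V.lookup w i ≟F x) (allFin⁺ n) (allFin⁺ n) σ
      (λ _ e → ∈-allFin _ , e) (λ _ _ _ _ → σ-inj)
      (λ {y} _ e → let (z , σz≡y) = injective⇒surjective σ σ-inj y
                   in z , ∈-allFin z , subst (λ j → V.lookup w j ≡ x) (sym σz≡y) e , σz≡y)

  csuc-val : ∀ {n} (i : Fin n) → suc (toℕ i) < n → toℕ (csuc i) ≡ suc (toℕ i)
  csuc-val {suc n} i (s≤s i+1<n) = trans (toℕ-fromℕ< _) (m≤n⇒m%n≡m i+1<n)

  csuc-last : ∀ {n} (i : Fin n) → ¬ (suc (toℕ i) < n) → toℕ (csuc i) ≡ 0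
  csuc-last {suc n} i not< = trans (toℕ-fromℕ< _) (trans (cong (λ z → suc z % suc n) i≡n) (n%n≡0 (suc n)))
    where
    i≡n : toℕ i ≡ n
    i≡n = ≤-antisym (<⇒≤pred (toℕ<n i)) (≮⇒≥ (λ i<n → not< (s≤s i<n)))

  csuc-injective : ∀ {n} {i j : Fin n} → csuc i ≡ csuc j → i ≡ j
  csuc-injective {n} {i} {j} eq with suc (toℕ i) <? n | suc (toℕ j) <? n
  ... | yes i< | yes j< = toℕ-injective (suc-injective (trans (sym (csuc-val i i<)) (trans (cong toℕ eq) (csuc-val j j<))))
  ... | yes i< | no j≮ = ⊥-elim (1+n≢0 (trans (sym (csuc-val i i<)) (trans (cong toℕ eq) (csuc-last j j≮))))
  ... | no i≮ | yes j< = ⊥-elim (1+n≢0 (trans (sym (csuc-val j j<)) (trans (cong toℕ (sym eq)) (csuc-last i i≮))))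
  ... | no i≮ | no j≮ = toℕ-injective (suc-injective (trans (last i i≮) (sym (last j j≮))))
    where
    last : ∀ (x : Fin n) → ¬ (suc (toℕ x) < n) → suc (toℕ x) ≡ n
    last x x≮ = ≤-antisym (toℕ<n x) (≮⇒≥ x≮)

  rotate : ∀ {n} → ℕ → Fin n → Fin n
  rotate zero    i = i
  rotate (suc m) i = csuc (rotate m i)

  rotate-injective : ∀ {n} m {i j : Fin n} → rotate m i ≡ rotate m j → i ≡ j
  rotate-injective zero    eq = eq
  rotate-injective (suc m) eq = rotate-injective m (csuc-injective eq)

  rotate-csuc : ∀ {n} m (i : Fin n) → rotate m (csuc i) ≡ csuc (rotate m i)
  rotate-csuc zero    i = refl
  rotate-csuc (suc m) i = cong csuc (rotate-csuc m i)

  rotate-from-0 : ∀ {n} m (z : Fin n) → toℕ z ≡ 0 → m < n → toℕ (rotate m z) ≡ m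
  rotate-from-0 zero    z z≡0 _   = z≡0
  rotate-from-0 (suc m) z z≡0 m<n = trans (csuc-val (rotate m z) (subst (λ j → suc j < _) (sym ih) m<n)) (cong suc ih)
    where
    ih : toℕ (rotate m z) ≡ m
    ih = rotate-from-0 m z z≡0 (<-trans (n<1+n m) m<n)

  -- The linear analogue of P^cyc: u is weakly increasing along positions 0, …, n-1,
  -- strictly so at the positions in J.
  Ascending : ∀ {m n} → Subset n → Vec (Fin m) n → Set
  Ascending {n = n} J u = ∀ i → suc (toℕ i) < n →
    V.lookup u i F.≤ V.lookup u (csuc i) × (i ∈ J → V.lookup u i F.< V.lookup u (csuc i))

  ascending? : ∀ {m n} (J : Subset n) (u : Vec (Fin m) n) → Dec (Ascending J u)
  ascending? {n = n} J u = all? (λ i → (suc (toℕ i) <? n) →-dec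
    ((V.lookup u i F.≤? V.lookup u (csuc i)) ×-dec ((i ∈? J) →-dec (V.lookup u i F.<? V.lookup u (csuc i)))))

module SkewShapes where

  open Counting
  open Enumeration
  open import Data.Nat using (ℕ; zero; suc; _+_; _∸_; _≤_; _<_; z≤n; s≤s)
  open import Data.Nat.Properties
  open import Data.Fin as F using (Fin)
  open import Data.List as L using (List; _∷_; length; map; upTo)
  open import Data.List.Membership.Propositional using (_∈_)
  open import Data.List.Membership.Propositional.Properties
    using (∈-map⁺; ∈-map⁻; ∈-concat⁺′; ∈-concat⁻′; ∈-upTo⁺; ∈-upTo⁻; ∈-lookup)
  open import Data.List.Relation.Unary.Any using (there; index)
  open import Data.List.Relation.Unary.Any.Properties using (lookup-index)
  open import Data.List.Relation.Unary.All as All using (All)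
  open import Data.List.Relation.Unary.AllPairs using (_∷_)
  open import Data.List.Relation.Unary.Unique.Propositional using (Unique)
  open import Data.List.Relation.Unary.Unique.Propositional.Properties using (upTo⁺)
  open import Data.Product using (∃-syntax; _×_; _,_; proj₁; proj₂)
  open import Data.Sum using (inj₁; inj₂)
  open import Data.Empty using (⊥-elim)
  open import Relation.Binary.Definitions using (Transitive)
  open import Relation.Binary.PropositionalEquality using (_≡_; refl; sym; trans; cong; cong₂; subst)

  lookup-injective : ∀ {a} {A : Set a} {xs : List A} → Unique xs → ∀ {i j} → L.lookup xs i ≡ L.lookup xs j → i ≡ j
  lookup-injective {xs = x ∷ xs} (x∉ ∷ u) {F.zero}  {F.zero}  eq = refl
  lookup-injective {xs = x ∷ xs} (x∉ ∷ u) {F.zero}  {F.suc j} eq = ⊥-elim (All.lookup x∉ (∈-lookup j) eq)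
  lookup-injective {xs = x ∷ xs} (x∉ ∷ u) {F.suc i} {F.zero}  eq = ⊥-elim (All.lookup x∉ (∈-lookup i) (sym eq))
  lookup-injective {xs = x ∷ xs} (x∉ ∷ u) {F.suc i} {F.suc j} eq = cong F.suc (lookup-injective u eq)

  part-antitone : ∀ xs → IsPartition xs → ∀ {i j} → i ≤ j → part xs j ≤ part xs i
  part-antitone xs dec {i} {zero} z≤n = ≤-refl
  part-antitone xs dec {i} {suc j} i≤1+j with m≤n⇒m<n∨m≡n i≤1+j
  ... | inj₁ (s≤s i≤j) = ≤-trans (dec j) (part-antitone xs dec i≤j)
  ... | inj₂ refl      = ≤-refl

  part-index : ∀ xs i → 0 < part xs i → i < length xs
  part-index (x ∷ xs) zero    _   = s≤s z≤n
  part-index (x ∷ xs) (suc i) pos = s≤s (part-index xs i pos)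

  module SkewShape (la mu : List ℕ) (pla : IsPartition la) (pmu : IsPartition mu) (sub : mu ⊆ₚ la) where

    N : ℕ
    N = size la mu

    row : ℕ → List Cell
    row i = map (λ d → (i , part mu i + d)) (upTo (part la i ∸ part mu i))

    cells-unique : Unique (cells la mu)
    cells-unique = concatMap-unique row proj₁ row-index row-unique (upTo⁺ (length la))
      where
      row-index : ∀ {i x} → x ∈ row i → proj₁ x ≡ i
      row-index x∈ with ∈-map⁻ _ x∈
      ... | _ , _ , refl = refl
      row-unique : ∀ i → Unique (row i)
      row-unique i = map-unique _ (λ _ _ eq → +-cancelˡ-≡ (part mu i) _ _ (cong proj₂ eq)) (upTo⁺ _)

    cells-sound : ∀ {x} → x ∈ cells la mu → InShape la mu x
    cells-sound x∈ with ∈-concat⁻′ (map row (upTo (length la))) x∈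
    ... | ys , x∈ys , ys∈ with ∈-map⁻ row ys∈
    ... | i , _ , refl with ∈-map⁻ _ x∈ys
    ... | d , d∈ , refl = m≤m+n _ _ ,
      subst (part mu i + d <_) (m+[n∸m]≡n (sub i)) (+-monoʳ-< (part mu i) (∈-upTo⁻ d∈))

    cells-complete : ∀ i j → InShape la mu (i , j) → (i , j) ∈ cells la mu
    cells-complete i j (μi≤j , j<λi) =
      ∈-concat⁺′ in-row (∈-map⁺ row (∈-upTo⁺ (part-index la i (≤-<-trans z≤n j<λi))))
      where
      in-row : (i , j) ∈ row i
      in-row = subst (λ z → (i , z) ∈ row i) (m+[n∸m]≡n μi≤j)
        (∈-map⁺ (λ d → (i , part mu i + d)) (∈-upTo⁺ (∸-monoˡ-< j<λi μi≤j)))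

    r c : Fin N → ℕ
    r a = rowOf la mu a
    c a = colOf la mu a

    cellAt-inShape : ∀ a → InShape la mu (cellAt la mu a)
    cellAt-inShape a = cells-sound (∈-lookup a)

    position : ∀ i j → InShape la mu (i , j) → ∃[ a ] (r a ≡ i × c a ≡ j)
    position i j x∈ with cells-complete i j x∈
    ... | x∈cells = index x∈cells , cong proj₁ (sym (lookup-index x∈cells)) , cong proj₂ (sym (lookup-index x∈cells))

    same-cell : ∀ {a b} → r a ≡ r b → c a ≡ c b → a ≡ b
    same-cell r≡ c≡ = lookup-injective cells-unique (cong₂ _,_ r≡ c≡)

    module Filling (v : Fin N → ℕ) where
      RowWeak RowStrict ColStrict : Set
      RowWeak   = ∀ a b → RightOf (cellAt la mu a) (cellAt la mu b) → v a ≤ v b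
      RowStrict = ∀ a b → RightOf (cellAt la mu a) (cellAt la mu b) → v a < v b
      ColStrict = ∀ a b → Below (cellAt la mu a) (cellAt la mu b) → v a < v b

      -- A transitive relation between horizontally adjacent entries holds along a whole row,
      -- because a row of a skew shape has no gaps.
      along-row : ∀ {ℓ} {R : ℕ → ℕ → Set ℓ} → Transitive R →
        (∀ a b → RightOf (cellAt la mu a) (cellAt la mu b) → R (v a) (v b)) →
        ∀ a b → r a ≡ r b → c a < c b → R (v a) (v b)
      along-row {R = R} R-trans next a b r≡ ca<cb = go (c b ∸ suc (c a)) b r≡ (sym (m+[n∸m]≡n ca<cb))
        where
        go : ∀ d b → r a ≡ r b → c b ≡ suc (c a) + d → R (v a) (v b)
        go zero    b r≡ c≡ = next a b (sym r≡ , trans c≡ (cong suc (+-identityʳ (c a))))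
        go (suc d) b r≡ c≡ with position (r a) (suc (c a) + d)
            (≤-trans (proj₁ (cellAt-inShape a)) (≤-trans (n≤1+n (c a)) (m≤m+n (suc (c a)) d)) ,
             <-trans (subst (suc (c a) + d <_) (sym c≡) (+-monoʳ-< (suc (c a)) (n<1+n d)))
                     (subst (λ i → c b < part la i) (sym r≡) (proj₂ (cellAt-inShape b))))
        ... | x , rx , cx = R-trans (go d x (sym rx) cx)
          (next x b (trans (sym r≡) (sym rx) , trans c≡ (trans (+-suc (suc (c a)) d) (cong suc (sym cx)))))

      -- Likewise down a column: a column of a skew shape has no gaps either.
      along-column : ∀ {ℓ} {R : ℕ → ℕ → Set ℓ} → Transitive R →
        (∀ a b → Below (cellAt la mu a) (cellAt la mu b) → R (v a) (v b)) →
        ∀ a b → c a ≡ c b → r a < r b → R (v a) (v b)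
      along-column {R = R} R-trans next a b c≡ ra<rb = go (r b ∸ suc (r a)) b c≡ (sym (m+[n∸m]≡n ra<rb))
        where
        go : ∀ d b → c a ≡ c b → r b ≡ suc (r a) + d → R (v a) (v b)
        go zero    b c≡ r≡ = next a b (trans r≡ (cong suc (+-identityʳ (r a))) , sym c≡)
        go (suc d) b c≡ r≡ with position (suc (r a) + d) (c a)
            (≤-trans (part-antitone mu pmu (≤-trans (n≤1+n (r a)) (m≤m+n (suc (r a)) d))) (proj₁ (cellAt-inShape a)) ,
             <-≤-trans (subst (λ j → j < part la (r b)) (sym c≡) (proj₂ (cellAt-inShape b)))
                       (part-antitone la pla (subst (suc (r a) + d ≤_) (sym r≡) (+-monoʳ-≤ (suc (r a)) (n≤1+n d)))))
        ... | x , rx , cx = R-trans (go d x (sym cx) rx)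
          (next x b (trans r≡ (trans (+-suc (suc (r a)) d) (cong suc (sym rx))) , trans (sym c≡) (sym cx)))

      row-weak : RowWeak → ∀ a b → r a ≡ r b → c a ≤ c b → v a ≤ v b
      row-weak weak a b r≡ ca≤cb with m≤n⇒m<n∨m≡n ca≤cb
      ... | inj₁ ca<cb = along-row {R = _≤_} ≤-trans weak a b r≡ ca<cb
      ... | inj₂ ca≡cb = ≤-reflexive (cong v (same-cell r≡ ca≡cb))

      -- In a row-weak, column-strict filling, an entry is smaller than every entry weakly
      -- right of it in a lower row: pass through the cell of that row in its own column.
      below-right : RowWeak → ColStrict → ∀ a b → r a < r b → c a ≤ c b → v a < v b
      below-right weak strict a b ra<rb ca≤cb with position (r b) (c a)
          (≤-trans (part-antitone mu pmu (<⇒≤ ra<rb)) (proj₁ (cellAt-inShape a)) ,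
           ≤-<-trans ca≤cb (proj₂ (cellAt-inShape b)))
      ... | x , rx , cx = <-≤-trans (along-column {R = _<_} <-trans strict a x (sym cx) (subst (r a <_) (sym rx) ra<rb))
                                    (row-weak weak x b rx (subst (_≤ c b) (sym cx) ca≤cb))

module Tableaux where

  open Counting
  open Enumeration
  open FiniteWords
  open SkewShapes
  open import Data.Nat using (ℕ; zero; suc; _+_; _∸_; _≤_; _<_; _≟_; _<?_; s≤s)
  open import Data.Nat.Properties
  open import Data.Fin as F using (Fin; toℕ; fromℕ<)
  open import Data.Fin.Properties using (toℕ-injective; toℕ-fromℕ<; toℕ<n) renaming (_≟_ to _≟F_)
  open import Data.Vec as V using (Vec)
  open import Data.Vec.Properties using (lookup∘tabulate)
  open import Data.List as L using (List; length; filter; allFin)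
  open import Data.List.Properties using (filter-≐; filter-notAll; length-tabulate)
  import Data.List.Relation.Unary.Any as Any
  open import Data.List.Membership.Propositional.Properties using (∈-allFin)
  open import Data.List.Relation.Unary.Unique.Propositional.Properties using (allFin⁺)
  open import Data.Product using (_×_; _,_; proj₁; proj₂)
  open import Data.Sum using (_⊎_; inj₁; inj₂)
  open import Data.Empty using (⊥-elim)
  open import Function using (_∘_)
  open import Relation.Nullary using (¬_; Dec; yes; no)
  open import Relation.Nullary.Decidable using (toWitness; fromWitness; _×-dec_; _⊎-dec_)
  open import Relation.Binary.Definitions using (tri<; tri≈; tri>)
  open import Relation.Binary.PropositionalEquality
    using (_≡_; _≢_; refl; sym; trans; cong; subst; subst₂; module ≡-Reasoning)

  module Standardization (la mu : List ℕ) (pla : IsPartition la) (pmu : IsPartition mu) (sub : mu ⊆ₚ la) where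
    open SkewShape la mu pla pmu sub

    entry : SYT la mu → Fin N → Fin N
    entry T a = V.lookup (proj₁ T) a

    isSYT : (T : SYT la mu) → IsSYT la mu (proj₁ T)
    isSYT (T , t) = toWitness {a? = isSYT? la mu T} t

    entry-injective : (T : SYT la mu) → ∀ {a b} → entry T a ≡ entry T b → a ≡ b
    entry-injective T = proj₁ (isSYT T) _ _

    holding : SYT la mu → Fin N → Fin N
    holding T i = proj₁ (injective⇒surjective (entry T) (entry-injective T) i)

    entry-holding : (T : SYT la mu) → ∀ i → entry T (holding T i) ≡ i
    entry-holding T i = proj₂ (injective⇒surjective (entry T) (entry-injective T) i)

    holding-entry : (T : SYT la mu) → ∀ a → holding T (entry T a) ≡ a
    holding-entry T a = entry-injective T (entry-holding T (entry T a))

    module Entries (T : SYT la mu) where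
      open Filling (toℕ ∘ entry T) public

      rowStrict : RowStrict
      rowStrict = proj₁ (proj₂ (isSYT T))

      rowWeak : RowWeak
      rowWeak a b adj = <⇒≤ (rowStrict a b adj)

      colStrict : ColStrict
      colStrict = proj₂ (proj₂ (isSYT T))

      southeast-≤ : ∀ a b → r a ≤ r b → c a ≤ c b → toℕ (entry T a) ≤ toℕ (entry T b)
      southeast-≤ a b ra≤rb ca≤cb with m≤n⇒m<n∨m≡n ra≤rb
      ... | inj₁ ra<rb = <⇒≤ (below-right rowWeak colStrict a b ra<rb ca≤cb)
      ... | inj₂ ra≡rb = row-weak rowWeak a b ra≡rb ca≤cb

    Precedes : (Fin N → ℕ) → Fin N → Fin N → Set
    Precedes v b a = v b < v a ⊎ (v b ≡ v a × c b < c a)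

    precedes? : ∀ v b a → Dec (Precedes v b a)
    precedes? v b a = (v b <? v a) ⊎-dec ((v b ≟ v a) ×-dec (c b <? c a))

    Precedes-irrefl : ∀ v a → ¬ Precedes v a a
    Precedes-irrefl v a (inj₁ lt)       = <-irrefl refl lt
    Precedes-irrefl v a (inj₂ (_ , lt)) = <-irrefl refl lt

    Precedes-trans : ∀ v {a b d} → Precedes v a b → Precedes v b d → Precedes v a d
    Precedes-trans v (inj₁ x)        (inj₁ y)         = inj₁ (<-trans x y)
    Precedes-trans v (inj₁ x)        (inj₂ (e , _))   = inj₁ (<-≤-trans x (≤-reflexive e))
    Precedes-trans v (inj₂ (e , _))  (inj₁ y)         = inj₁ (≤-<-trans (≤-reflexive e) y)
    Precedes-trans v (inj₂ (e , x))  (inj₂ (e' , y))  = inj₂ (trans e e' , <-trans x y)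

    Precedes-asym : ∀ v {a b} → Precedes v a b → ¬ Precedes v b a
    Precedes-asym v ab ba = Precedes-irrefl v _ (Precedes-trans v ab ba)

    Precedes⇒≤ : ∀ v {a b} → Precedes v a b → v a ≤ v b
    Precedes⇒≤ v (inj₁ lt)       = <⇒≤ lt
    Precedes⇒≤ v (inj₂ (eq , _)) = ≤-reflexive eq

    rank : (Fin N → ℕ) → Fin N → ℕ
    rank v a = length (filter (λ b → precedes? v b a) (allFin N))

    rank-cong : ∀ {v w} → (∀ a → v a ≡ w a) → ∀ a → rank v a ≡ rank w a
    rank-cong {v} {w} v≡w a = cong length (filter-≐ (λ b → precedes? v b a) (λ b → precedes? w b a) (to , from) (allFin N))
      where
      to : ∀ {b} → Precedes v b a → Precedes w b a
      to (inj₁ lt)        = inj₁ (subst₂ _<_ (v≡w _) (v≡w a) lt)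
      to (inj₂ (e , lt))  = inj₂ (trans (sym (v≡w _)) (trans e (v≡w a)) , lt)
      from : ∀ {b} → Precedes w b a → Precedes v b a
      from (inj₁ lt)       = inj₁ (subst₂ _<_ (sym (v≡w _)) (sym (v≡w a)) lt)
      from (inj₂ (e , lt)) = inj₂ (trans (v≡w _) (trans e (sym (v≡w a))) , lt)

    rank-mono : ∀ v {a b} → Precedes v a b → rank v a < rank v b
    rank-mono v {a} {b} a≺b = filter-length-strict (λ x → precedes? v x a) (λ x → precedes? v x b)
      (λ x≺a → Precedes-trans v x≺a a≺b) (∈-allFin a) a≺b (Precedes-irrefl v a)

    rank<N : ∀ v a → rank v a < N
    rank<N v a = subst (rank v a <_) (length-tabulate {n = N} (λ i → i))
      (filter-notAll (λ b → precedes? v b a) (allFin N) (Any.map (λ { refl → Precedes-irrefl v a }) (∈-allFin a)))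

    module Compatible (T : SYT la mu) (u : Fin N → ℕ)
      (weak : ∀ i → suc (toℕ i) < N → u i ≤ u (csuc i))
      (strict : ∀ i → suc (toℕ i) < N → IsDescent la mu T i → u i < u (csuc i)) where
      open Entries T

      private
        step-bound : ∀ d (i j : Fin N) → toℕ j ≡ toℕ i + suc d → suc (toℕ i) < N
        step-bound d i j j≡ = ≤-<-trans (subst (suc (toℕ i) ≤_) (trans (sym (+-suc (toℕ i) d)) (sym j≡))
                                               (s≤s (m≤m+n (toℕ i) d))) (toℕ<n j)
        step-distance : ∀ d (i j : Fin N) (j≡ : toℕ j ≡ toℕ i + suc d) → toℕ j ≡ toℕ (csuc i) + d
        step-distance d i j j≡ = trans j≡ (trans (+-suc (toℕ i) d) (cong (_+ d) (sym (csuc-val i (step-bound d i j j≡)))))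
        same-position : ∀ (i j : Fin N) → toℕ j ≡ toℕ i + 0 → i ≡ j
        same-position i j j≡ = toℕ-injective (sym (trans j≡ (+-identityʳ (toℕ i))))

      monotone : ∀ i j → toℕ i ≤ toℕ j → u i ≤ u j
      monotone i j i≤j = go (toℕ j ∸ toℕ i) i j (sym (m+[n∸m]≡n i≤j))
        where
        go : ∀ d i j → toℕ j ≡ toℕ i + d → u i ≤ u j
        go zero    i j j≡ = ≤-reflexive (cong u (same-position i j j≡))
        go (suc d) i j j≡ = ≤-trans (weak i (step-bound d i j j≡)) (go d (csuc i) j (step-distance d i j j≡))

      -- On a stretch where u is constant there is no descent, so the rows of the
      -- corresponding entries weakly rise.
      plateau-rows : ∀ i j → toℕ i ≤ toℕ j → u i ≡ u j → r (holding T j) ≤ r (holding T i)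
      plateau-rows i j i≤j = go (toℕ j ∸ toℕ i) i j (sym (m+[n∸m]≡n i≤j))
        where
        go : ∀ d i j → toℕ j ≡ toℕ i + d → u i ≡ u j → r (holding T j) ≤ r (holding T i)
        go zero    i j j≡ _   = ≤-reflexive (cong (r ∘ holding T) (sym (same-position i j j≡)))
        go (suc d) i j j≡ ui≡uj = ≤-trans (go d i' j (step-distance d i j j≡) (trans (sym ui≡ui') ui≡uj)) no-descent
          where
          i' : Fin N
          i' = csuc i
          i+1<N : suc (toℕ i) < N
          i+1<N = step-bound d i j j≡
          ui≡ui' : u i ≡ u i'
          ui≡ui' = ≤-antisym (weak i i+1<N)
            (subst (u i' ≤_) (sym ui≡uj)
              (monotone i' j (subst (toℕ i' ≤_) (sym (step-distance d i j j≡)) (m≤m+n (toℕ i') d))))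
          no-descent : r (holding T i') ≤ r (holding T i)
          no-descent = ≮⇒≥ (λ rise → <-irrefl ui≡ui' (strict i i+1<N
            (holding T i , holding T i' , cong toℕ (entry-holding T i) ,
             trans (cong toℕ (entry-holding T i')) (csuc-val i i+1<N) , rise)))

      U : Fin N → ℕ
      U a = u (entry T a)

      U-rowWeak : Filling.RowWeak U
      U-rowWeak a b adj = monotone (entry T a) (entry T b) (<⇒≤ (rowStrict a b adj))

      U-colStrict : Filling.ColStrict U
      U-colStrict a b adj with m≤n⇒m<n∨m≡n (monotone (entry T a) (entry T b) (<⇒≤ (colStrict a b adj)))
      ... | inj₁ Ua<Ub = Ua<Ub
      ... | inj₂ Ua≡Ub = ⊥-elim (<⇒≱ (subst (r a <_) (sym (proj₁ adj)) ≤-refl) rows-rise)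
        where
        rows-rise : r b ≤ r a
        rows-rise = subst₂ (λ x y → r x ≤ r y) (holding-entry T b) (holding-entry T a)
          (plateau-rows (entry T a) (entry T b) (<⇒≤ (colStrict a b adj)) Ua≡Ub)

      reading-order : ∀ a b → toℕ (entry T b) < toℕ (entry T a) → Precedes U b a
      reading-order a b Tb<Ta with m≤n⇒m<n∨m≡n (monotone (entry T b) (entry T a) (<⇒≤ Tb<Ta))
      ... | inj₁ Ub<Ua = inj₁ Ub<Ua
      ... | inj₂ Ub≡Ua = inj₂ (Ub≡Ua , ≰⇒> (λ ca≤cb → <⇒≱ Tb<Ta (southeast-≤ a b ra≤rb ca≤cb)))
        where
        ra≤rb : r a ≤ r b
        ra≤rb = subst₂ (λ x y → r x ≤ r y) (holding-entry T a) (holding-entry T b)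
          (plateau-rows (entry T b) (entry T a) (<⇒≤ Tb<Ta) Ub≡Ua)

      reading-order⁻ : ∀ a b → Precedes U b a → toℕ (entry T b) < toℕ (entry T a)
      reading-order⁻ a b b≺a with <-cmp (toℕ (entry T b)) (toℕ (entry T a))
      ... | tri< Tb<Ta _ _ = Tb<Ta
      ... | tri≈ _ Tb≡Ta _ = ⊥-elim (Precedes-irrefl U a
              (subst (λ x → Precedes U x a) (entry-injective T (toℕ-injective Tb≡Ta)) b≺a))
      ... | tri> _ _ Ta<Tb = ⊥-elim (Precedes-asym U b≺a (reading-order b a Ta<Tb))

      rank-U : ∀ a → rank U a ≡ toℕ (entry T a)
      rank-U a = begin
        rank U a
          ≡⟨ cong length (filter-≐ (λ b → precedes? U b a) (λ b → toℕ (entry T b) <? t)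
               ((λ {b} → reading-order⁻ a b) , (λ {b} → reading-order a b)) (allFin N)) ⟩
        length (filter (λ b → toℕ (entry T b) <? t) (allFin N))
          ≡⟨ count-bijection (λ b → toℕ (entry T b) <? t) (λ i → toℕ i <? t) (allFin⁺ N) (allFin⁺ N) (entry T)
               (λ _ lt → ∈-allFin _ , lt) (λ _ _ _ _ → entry-injective T)
               (λ {i} _ lt → holding T i , ∈-allFin _ ,
                             subst (λ z → toℕ z < t) (sym (entry-holding T i)) lt , entry-holding T i) ⟩
        length (filter (λ i → toℕ i <? t) (allFin N))
          ≡⟨ count-below N t (<⇒≤ (toℕ<n (entry T a))) ⟩
        t ∎
        where
        open ≡-Reasoning
        t : ℕ
        t = toℕ (entry T a)

    module Standardize (v : Fin N → ℕ) (weak : Filling.RowWeak v) (strict : Filling.ColStrict v) where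
      open Filling v

      -- Equal values never share a column, so the reading order is total.
      equal-column : ∀ a b → v a ≡ v b → c a ≡ c b → a ≡ b
      equal-column a b va≡vb ca≡cb with <-cmp (r a) (r b)
      ... | tri< ra<rb _ _ = ⊥-elim (<-irrefl va≡vb (below-right weak strict a b ra<rb (≤-reflexive ca≡cb)))
      ... | tri≈ _ ra≡rb _ = same-cell ra≡rb ca≡cb
      ... | tri> _ _ rb<ra = ⊥-elim (<-irrefl (sym va≡vb) (below-right weak strict b a rb<ra (≤-reflexive (sym ca≡cb))))

      total : ∀ a b → a ≢ b → Precedes v a b ⊎ Precedes v b a
      total a b a≢b with <-cmp (v a) (v b) | <-cmp (c a) (c b)
      ... | tri< va<vb _ _ | _              = inj₁ (inj₁ va<vb)
      ... | tri> _ _ vb<va | _              = inj₂ (inj₁ vb<va)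
      ... | tri≈ _ va≡vb _ | tri< ca<cb _ _ = inj₁ (inj₂ (va≡vb , ca<cb))
      ... | tri≈ _ va≡vb _ | tri≈ _ ca≡cb _ = ⊥-elim (a≢b (equal-column a b va≡vb ca≡cb))
      ... | tri≈ _ va≡vb _ | tri> _ _ cb<ca = inj₂ (inj₂ (sym va≡vb , cb<ca))

      lower-row : ∀ a b → Precedes v a b → r a < r b → v a < v b
      lower-row a b (inj₁ va<vb)      _     = va<vb
      lower-row a b (inj₂ (_ , ca<cb)) ra<rb = below-right weak strict a b ra<rb (<⇒≤ ca<cb)

      rank-injective : ∀ {a b} → rank v a ≡ rank v b → a ≡ b
      rank-injective {a} {b} eq with a ≟F b
      ... | yes a≡b = a≡b
      ... | no a≢b with total a b a≢b
      ...   | inj₁ a≺b = ⊥-elim (<-irrefl eq (rank-mono v a≺b))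
      ...   | inj₂ b≺a = ⊥-elim (<-irrefl (sym eq) (rank-mono v b≺a))

      rank-reflects : ∀ {a b} → rank v a < rank v b → Precedes v a b
      rank-reflects {a} {b} lt with a ≟F b
      ... | yes refl = ⊥-elim (<-irrefl refl lt)
      ... | no a≢b with total a b a≢b
      ...   | inj₁ a≺b = a≺b
      ...   | inj₂ b≺a = ⊥-elim (<-asym lt (rank-mono v b≺a))

      std : Vec (Fin N) N
      std = V.tabulate (λ a → fromℕ< (rank<N v a))

      std-rank : ∀ a → toℕ (V.lookup std a) ≡ rank v a
      std-rank a = trans (cong toℕ (lookup∘tabulate (λ a → fromℕ< (rank<N v a)) a)) (toℕ-fromℕ< _)

      std-injective : ∀ {a b} → V.lookup std a ≡ V.lookup std b → a ≡ b
      std-injective {a} {b} eq = rank-injective (trans (sym (std-rank a)) (trans (cong toℕ eq) (std-rank b)))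

      std-isSYT : IsSYT la mu std
      std-isSYT = (λ _ _ → std-injective) ,
        (λ a b adj → subst₂ _<_ (sym (std-rank a)) (sym (std-rank b)) (rank-mono v (along-row-precedes a b adj))) ,
        (λ a b adj → subst₂ _<_ (sym (std-rank a)) (sym (std-rank b)) (rank-mono v (inj₁ (strict a b adj))))
        where
        along-row-precedes : ∀ a b → RightOf (cellAt la mu a) (cellAt la mu b) → Precedes v a b
        along-row-precedes a b adj with m≤n⇒m<n∨m≡n (weak a b adj)
        ... | inj₁ va<vb = inj₁ va<vb
        ... | inj₂ va≡vb = inj₂ (va≡vb , subst (c a <_) (sym (proj₂ adj)) ≤-refl)

      stdT : SYT la mu
      stdT = std , fromWitness {a? = isSYT? la mu std} std-isSYT

      read : Fin N → Fin N
      read = holding stdT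

      rank-read : ∀ i → rank v (read i) ≡ toℕ i
      rank-read i = trans (sym (std-rank (read i))) (cong toℕ (entry-holding stdT i))

      read-precedes : ∀ i → suc (toℕ i) < N → Precedes v (read i) (read (csuc i))
      read-precedes i i+1<N = rank-reflects {read i} {read (csuc i)} (subst₂ _<_ (sym (rank-read i))
        (sym (trans (rank-read (csuc i)) (csuc-val i i+1<N))) ≤-refl)

      read-weak : ∀ i → suc (toℕ i) < N → v (read i) ≤ v (read (csuc i))
      read-weak i i+1<N = Precedes⇒≤ v (read-precedes i i+1<N)

      read-strict : ∀ i → suc (toℕ i) < N → IsDescent la mu stdT i → v (read i) < v (read (csuc i))
      read-strict i i+1<N (a , b , a↦i , b↦i+1 , ra<rb) = lower-row (read i) (read (csuc i)) (read-precedes i i+1<N) rows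
        where
        located : ∀ {x j} → toℕ (V.lookup std x) ≡ toℕ j → x ≡ read j
        located {x} {j} eq = std-injective (toℕ-injective (trans eq (cong toℕ (sym (entry-holding stdT j)))))
        rows : r (read i) < r (read (csuc i))
        rows = subst₂ (λ x y → r x < r y) (located a↦i) (located (trans b↦i+1 (sym (csuc-val i i+1<N)))) ra<rb

module GesselLemma where

  open Counting
  open Enumeration
  open FiniteWords
  open SkewShapes
  open Tableaux
  open import Data.Nat using (ℕ; suc; _≤_; _<_)
  open import Data.Nat.ListAction using (sum)
  open import Data.Fin as F using (Fin; toℕ)
  open import Data.Fin.Properties using (toℕ-injective)
  open import Data.Fin.Subset using (Subset; _∈_)
  open import Data.Vec as V using (Vec)
  open import Data.Vec.Properties using (lookup∘tabulate)
  open import Data.List as L using (List; length; map; filter; cartesianProduct)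
  open import Data.List.Membership.Propositional using () renaming (_∈_ to _∈ₗ_)
  open import Data.List.Membership.Propositional.Properties using (∈-cartesianProduct⁺; ∈-cartesianProduct⁻)
  open import Data.List.Relation.Unary.Unique.Propositional.Properties using (cartesianProduct⁺)
  open import Data.Product using (∃-syntax; _×_; _,_; proj₁; proj₂)
  open import Function.Bundles using (_⇔_; Equivalence)
  open import Relation.Nullary using (Dec)
  open import Relation.Binary.PropositionalEquality
    using (_≡_; refl; sym; trans; cong; cong₂; subst₂; module ≡-Reasoning)

  -- The descent
  -- set may be given by any D agreeing with Des on [n-1].
  module Fundamental (la mu : List ℕ) (pla : IsPartition la) (pmu : IsPartition mu) (sub : mu ⊆ₚ la)
    (D : SYT la mu → Subset (size la mu))
    (D-descents : ∀ T i → suc (toℕ i) < size la mu → (i ∈ D T ⇔ IsDescent la mu T i))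
    (α : List ℕ) where
    open SkewShape la mu pla pmu sub
    open Standardization la mu pla pmu sub

    W : Set
    W = Vec (Fin (length α)) N

    values : W → Fin N → ℕ
    values S a = toℕ (V.lookup S a)

    Φ : SYT la mu → W → W
    Φ T u = V.tabulate (λ a → V.lookup u (entry T a))

    Φ-lookup : ∀ T u a → V.lookup (Φ T u) a ≡ V.lookup u (entry T a)
    Φ-lookup T u a = lookup∘tabulate (λ a → V.lookup u (entry T a)) a

    Φ-content : ∀ T u x → occ x (Φ T u) ≡ occ x u
    Φ-content T u x = occ-permute x u (entry T) (entry-injective T)

    module _ (T : SYT la mu) (u : W) (asc : Ascending (D T) u) where
      private
        open Compatible T (values u) (λ i lt → proj₁ (asc i lt))
          (λ i lt d → proj₂ (asc i lt) (Equivalence.from (D-descents T i lt) d))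

        values-Φ : ∀ a → values (Φ T u) a ≡ U a
        values-Φ a = cong toℕ (Φ-lookup T u a)

      Φ-SSYT : IsSSYT la mu (Φ T u)
      Φ-SSYT = (λ a b adj → subst₂ _≤_ (sym (values-Φ a)) (sym (values-Φ b)) (U-rowWeak a b adj)) ,
               (λ a b adj → subst₂ _<_ (sym (values-Φ a)) (sym (values-Φ b)) (U-colStrict a b adj))

      Φ-rank : ∀ a → rank (values (Φ T u)) a ≡ toℕ (entry T a)
      Φ-rank a = trans (rank-cong values-Φ a) (rank-U a)

    -- Every semistandard filling S arises: from its standardization and its reading word.
    module ReadingWord (S : W) (ssyt : IsSSYT la mu S) where
      private
        module Standardized = Standardize (values S) (proj₁ ssyt) (proj₂ ssyt)
      open Standardized public using (stdT)
      open Standardized hiding (stdT)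

      word : W
      word = V.tabulate (λ i → V.lookup S (read i))

      word-lookup : ∀ i → V.lookup word i ≡ V.lookup S (read i)
      word-lookup i = lookup∘tabulate (λ i → V.lookup S (read i)) i

      word-ascending : Ascending (D stdT) word
      word-ascending i i+1<N =
        subst₂ _≤_ (values-word i) (values-word (csuc i)) (read-weak i i+1<N) ,
        λ i∈D → subst₂ _<_ (values-word i) (values-word (csuc i))
                  (read-strict i i+1<N (Equivalence.to (D-descents stdT i i+1<N) i∈D))
        where
        values-word : ∀ j → values S (read j) ≡ toℕ (V.lookup word j)
        values-word j = cong toℕ (sym (word-lookup j))

      word-content : ∀ x → occ x word ≡ occ x S
      word-content x = occ-permute x S read read-injective
        where
        read-injective : ∀ {i j} → read i ≡ read j → i ≡ j
        read-injective {i} {j} eq = trans (sym (entry-holding stdT i)) (trans (cong (entry stdT) eq) (entry-holding stdT j))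

      Φ-word : Φ stdT word ≡ S
      Φ-word = vec-ext _ _ (λ a → trans (Φ-lookup stdT word a)
        (trans (word-lookup (entry stdT a)) (cong (V.lookup S) (holding-entry stdT a))))

    fundamental : sum (map (λ T → length (filter (ascending? (D T)) (Words α N))) (allSYT la mu))
                ≡ length (filter (isSSYT? la mu) (Words α N))
    fundamental = trans (sym (count-pairs compatible? (allSYT la mu) (Words α N)))
      (count-bijection compatible? (isSSYT? la mu) (cartesianProduct⁺ (allSYT-unique la mu) (words-unique α N))
         (words-unique α N) (λ (T , u) → Φ T u) into injective onto)
      where
      Pairs : List (SYT la mu × W)
      Pairs = cartesianProduct (allSYT la mu) (Words α N)

      Compatible-pair : SYT la mu × W → Set
      Compatible-pair (T , u) = Ascending (D T) u

      compatible? : ∀ p → Dec (Compatible-pair p)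
      compatible? (T , u) = ascending? (D T) u

      into : ∀ {p} → p ∈ₗ Pairs → Compatible-pair p →
             Φ (proj₁ p) (proj₂ p) ∈ₗ Words α N × IsSSYT la mu (Φ (proj₁ p) (proj₂ p))
      into {T , u} p∈ asc =
        ∈-words⁺ {α} (Φ T u) (λ x → trans (Φ-content T u x) (∈-words⁻ {α} u∈ x)) , Φ-SSYT T u asc
        where
        u∈ : u ∈ₗ Words α N
        u∈ = proj₂ (∈-cartesianProduct⁻ (allSYT la mu) (Words α N) p∈)

      injective : ∀ {p q} → p ∈ₗ Pairs → q ∈ₗ Pairs → Compatible-pair p → Compatible-pair q →
                  Φ (proj₁ p) (proj₂ p) ≡ Φ (proj₁ q) (proj₂ q) → p ≡ q
      injective {T , u} {T' , u'} _ _ asc asc' eq = cong₂ _,_ T≡T' (same-word T≡T')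
        where
        T≡T' : T ≡ T'
        T≡T' = SYT-≡ {la} {mu} T T' (vec-ext _ _ (λ a → toℕ-injective
          (trans (sym (Φ-rank T u asc a)) (trans (cong (λ S → rank (values S) a) eq) (Φ-rank T' u' asc' a)))))
        same-word : T ≡ T' → u ≡ u'
        same-word refl = vec-ext u u' (λ i → begin
          V.lookup u i                        ≡⟨ cong (V.lookup u) (sym (entry-holding T i)) ⟩
          V.lookup u (entry T (holding T i))  ≡⟨ sym (Φ-lookup T u (holding T i)) ⟩
          V.lookup (Φ T u) (holding T i)      ≡⟨ cong (λ S → V.lookup S (holding T i)) eq ⟩
          V.lookup (Φ T u') (holding T i)     ≡⟨ Φ-lookup T u' (holding T i) ⟩
          V.lookup u' (entry T (holding T i)) ≡⟨ cong (V.lookup u') (entry-holding T i) ⟩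
          V.lookup u' i                       ∎)
          where open ≡-Reasoning

      onto : ∀ {S} → S ∈ₗ Words α N → IsSSYT la mu S →
             ∃[ p ] (p ∈ₗ Pairs × Compatible-pair p × Φ (proj₁ p) (proj₂ p) ≡ S)
      onto {S} S∈ ssyt = (stdT , word) ,
        ∈-cartesianProduct⁺ (allSYT-complete la mu stdT)
          (∈-words⁺ {α} word (λ x → trans (word-content x) (∈-words⁻ {α} S∈ x))) ,
        word-ascending , Φ-word
        where open ReadingWord S ssyt

module Rotations where

  open Counting
  open Enumeration
  open FiniteWords
  open import Data.Nat using (ℕ; suc; _<_; _<?_; z≤n)
  open import Data.Nat.Properties using (≤-<-trans; 1+n≢0)
  open import Data.Fin as F using (Fin; toℕ; fromℕ<)
  open import Data.Fin.Properties using (toℕ-injective; toℕ-fromℕ<; toℕ<n)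
  open import Data.Fin.Subset using (Subset; _∈_)
  open import Data.Vec as V using (Vec)
  open import Data.Vec.Properties using (lookup∘tabulate)
  open import Data.List as L using (List; length; filter)
  open import Data.Product using (∃-syntax; _×_; _,_; proj₁; proj₂)
  open import Data.Empty using (⊥-elim)
  open import Function.Bundles using (_⇔_; Equivalence)
  open import Relation.Nullary using (¬_; yes; no)
  open import Relation.Binary.PropositionalEquality
    using (_≡_; refl; sym; trans; cong; subst; subst₂; module ≡-Reasoning)
  import Data.List.Membership.Propositional as L

  -- Rotating a word by k positions turns the cyclic condition of P^cyc_{J',k} into the linear
  -- condition `Ascending J`, when J' is J rotated by k; rotation preserves content, so both
  -- conditions are satisfied by equally many words of content α.
  module Rotation {n : ℕ} (k : Fin n) (J J' : Subset n)
    (shifted : ∀ i → rotate (toℕ k) i ∈ J' ⇔ i ∈ J) (α : List ℕ) where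

    σ : Fin n → Fin n
    σ = rotate (toℕ k)

    σ-injective : ∀ {i j} → σ i ≡ σ j → i ≡ j
    σ-injective = rotate-injective (toℕ k)

    first : Fin n
    first = fromℕ< (≤-<-trans z≤n (toℕ<n k))

    σ-first : σ first ≡ k
    σ-first = toℕ-injective (rotate-from-0 (toℕ k) first (toℕ-fromℕ< _) (toℕ<n k))

    σ⁻¹ : Fin n → Fin n
    σ⁻¹ j = proj₁ (injective⇒surjective σ σ-injective j)

    σσ⁻¹ : ∀ j → σ (σ⁻¹ j) ≡ j
    σσ⁻¹ j = proj₂ (injective⇒surjective σ σ-injective j)

    σ⁻¹-injective : ∀ {i j} → σ⁻¹ i ≡ σ⁻¹ j → i ≡ j
    σ⁻¹-injective {i} {j} eq = trans (sym (σσ⁻¹ i)) (trans (cong σ eq) (σσ⁻¹ j))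

    W : Set
    W = Vec (Fin (length α)) n

    rot : W → W
    rot w = V.tabulate (λ i → V.lookup w (σ i))

    rot-lookup : ∀ w i → V.lookup (rot w) i ≡ V.lookup w (σ i)
    rot-lookup w i = lookup∘tabulate (λ i → V.lookup w (σ i)) i

    rot-lookup-next : ∀ w i → V.lookup (rot w) (csuc i) ≡ V.lookup w (csuc (σ i))
    rot-lookup-next w i = trans (rot-lookup w (csuc i)) (cong (V.lookup w) (rotate-csuc (toℕ k) i))

    not-cut : ∀ i → suc (toℕ i) < n → ¬ (csuc (σ i) ≡ k)
    not-cut i i+1<n eq = 1+n≢0 (trans (sym (csuc-val i i+1<n))
      (trans (cong toℕ (σ-injective (trans (rotate-csuc (toℕ k) i) (trans eq (sym σ-first))))) (toℕ-fromℕ< _)))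

    last-is-cut : ∀ i → ¬ (suc (toℕ i) < n) → csuc (σ i) ≡ k
    last-is-cut i last = trans (sym (rotate-csuc (toℕ k) i))
      (trans (cong σ (toℕ-injective (trans (csuc-last i last) (sym (toℕ-fromℕ< _))))) σ-first)

    cyclic⇒ascending : ∀ w → InPcyc J' w k → Ascending J (rot w)
    cyclic⇒ascending w (weak , strict) i i+1<n =
      subst₂ F._≤_ (sym (rot-lookup w i)) (sym (rot-lookup-next w i)) (weak (σ i) (not-cut i i+1<n)) ,
      λ i∈J → subst₂ F._<_ (sym (rot-lookup w i)) (sym (rot-lookup-next w i))
                (strict (σ i) (Equivalence.from (shifted i) i∈J) (not-cut i i+1<n))

    ascending⇒cyclic : ∀ w → Ascending J (rot w) → InPcyc J' w k
    ascending⇒cyclic w asc = (λ j j≠cut → proj₁ (at j j≠cut)) , (λ j j∈J' j≠cut → proj₂ (at j j≠cut) j∈J')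
      where
      at : ∀ j → ¬ (csuc j ≡ k) →
           V.lookup w j F.≤ V.lookup w (csuc j) × (j ∈ J' → V.lookup w j F.< V.lookup w (csuc j))
      at j j≠cut = from-position (σ⁻¹ j) (σσ⁻¹ j)
        where
        from-position : ∀ i → σ i ≡ j →
          V.lookup w j F.≤ V.lookup w (csuc j) × (j ∈ J' → V.lookup w j F.< V.lookup w (csuc j))
        from-position i refl with suc (toℕ i) <? n
        ... | no last    = ⊥-elim (j≠cut (last-is-cut i last))
        ... | yes i+1<n  =
          subst₂ F._≤_ (rot-lookup w i) (rot-lookup-next w i) (proj₁ (asc i i+1<n)) ,
          λ j∈J' → subst₂ F._<_ (rot-lookup w i) (rot-lookup-next w i)
                     (proj₂ (asc i i+1<n) (Equivalence.to (shifted i) j∈J'))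

    rotation-count : length (filter (λ w → inPcyc? J' w k) (Words α n)) ≡ length (filter (ascending? J) (Words α n))
    rotation-count = count-bijection (λ w → inPcyc? J' w k) (ascending? J) (words-unique α n) (words-unique α n)
      rot into injective onto
      where
      into : ∀ {w} → w L.∈ Words α n → InPcyc J' w k → rot w L.∈ Words α n × Ascending J (rot w)
      into {w} w∈ cyc = ∈-words⁺ {α} (rot w) (λ x → trans (occ-permute x w σ σ-injective) (∈-words⁻ {α} w∈ x)) ,
                        cyclic⇒ascending w cyc
      injective : ∀ {w w'} → w L.∈ Words α n → w' L.∈ Words α n → InPcyc J' w k → InPcyc J' w' k →
                  rot w ≡ rot w' → w ≡ w'
      injective {w} {w'} _ _ _ _ eq = vec-ext w w' (λ j → begin
        V.lookup w j             ≡⟨ cong (V.lookup w) (sym (σσ⁻¹ j)) ⟩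
        V.lookup w (σ (σ⁻¹ j))    ≡⟨ sym (rot-lookup w (σ⁻¹ j)) ⟩
        V.lookup (rot w) (σ⁻¹ j)  ≡⟨ cong (λ v → V.lookup v (σ⁻¹ j)) eq ⟩
        V.lookup (rot w') (σ⁻¹ j) ≡⟨ rot-lookup w' (σ⁻¹ j) ⟩
        V.lookup w' (σ (σ⁻¹ j))   ≡⟨ cong (V.lookup w') (σσ⁻¹ j) ⟩
        V.lookup w' j            ∎)
        where open ≡-Reasoning
      onto : ∀ {u} → u L.∈ Words α n → Ascending J u → ∃[ w ] (w L.∈ Words α n × InPcyc J' w k × rot w ≡ u)
      onto {u} u∈ asc =
        w , ∈-words⁺ {α} w (λ x → trans (occ-permute x u σ⁻¹ σ⁻¹-injective) (∈-words⁻ {α} u∈ x)) ,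
        ascending⇒cyclic w (subst (Ascending J) (sym rot-w) asc) , rot-w
        where
        w : W
        w = V.tabulate (λ j → V.lookup u (σ⁻¹ j))
        rot-w : rot w ≡ u
        rot-w = vec-ext (rot w) u (λ i → trans (rot-lookup w i)
          (trans (lookup∘tabulate (λ j → V.lookup u (σ⁻¹ j)) (σ i)) (cong (V.lookup u) (σ-injective (σσ⁻¹ (σ i))))))

module CyclicCounting where

  open Counting
  open Enumeration
  open FiniteWords
  open GesselLemma
  open Rotations
  open import Data.Nat using (ℕ; zero; suc)
  open import Data.Nat.ListAction using (sum)
  open import Data.Fin as F using (Fin; toℕ)
  open import Data.Fin.Subset using (Subset; _∈_)
  open import Data.List as L using (List; length; map; filter; allFin)
  open import Data.List.Properties using (map-cong)
  open import Data.List.Membership.Propositional.Properties using (∈-cartesianProduct⁺; ∈-cartesianProduct⁻)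
  open import Data.List.Relation.Unary.Unique.Propositional.Properties using (allFin⁺; cartesianProduct⁺)
  open import Data.Product using (∃-syntax; _,_; proj₁; proj₂; swap)
  open import Function.Bundles using (_⇔_)
  open import Function.Construct.Composition using (_⇔-∘_)
  open import Function.Construct.Identity using (⇔-id)
  open import Relation.Binary.PropositionalEquality using (_≡_; refl; sym; trans; cong)

  cyclicCount : ∀ {n} (α : List ℕ) → Subset n → Fin n → ℕ
  cyclicCount {n} α J k = length (filter (λ w → inPcyc? J w k) (Words α n))

  Fcyc-by-cut : ∀ n J α → Fcyc n J α ≡ sum (map (cyclicCount α J) (allFin n))
  Fcyc-by-cut n J α = trans
    (count-bijection (λ (w , k) → inPcyc? J w k) (λ (k , w) → inPcyc? J w k)
       (cartesianProduct⁺ (words-unique α n) (allFin⁺ n)) (cartesianProduct⁺ (allFin⁺ n) (words-unique α n)) swap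
       (λ {p} p∈ cyc → let (w∈ , k∈) = ∈-cartesianProduct⁻ (Words α n) (allFin n) p∈
                       in ∈-cartesianProduct⁺ k∈ w∈ , cyc)
       (λ _ _ _ _ → cong swap)
       (λ {q} q∈ cyc → let (k∈ , w∈) = ∈-cartesianProduct⁻ (allFin n) (Words α n) q∈
                       in swap q , ∈-cartesianProduct⁺ w∈ k∈ , cyc , refl))
    (count-pairs (λ (k , w) → inPcyc? J w k) (allFin n) (Words α n))

  module Iterates {la mu : List ℕ} (E : CyclicExtension la mu) where
    open CyclicExtension E

    pIter : ℕ → SYT la mu → SYT la mu
    pIter zero    T = T
    pIter (suc m) T = p (pIter m T)

    pIter-injective : ∀ m {S T} → pIter m S ≡ pIter m T → S ≡ T
    pIter-injective zero    eq = eq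
    pIter-injective (suc m) eq = pIter-injective m (proj₁ p-bij eq)

    pIter-surjective : ∀ m T → ∃[ S ] pIter m S ≡ T
    pIter-surjective zero    T = T , refl
    pIter-surjective (suc m) T =
      let (T' , pT'≡T) = p-surjective T ; (S , pIterS≡T') = pIter-surjective m T'
      in S , trans (cong p pIterS≡T') pT'≡T
      where
      p-surjective : ∀ T → ∃[ S ] p S ≡ T
      p-surjective T = proj₁ (proj₂ p-bij T) , proj₂ (proj₂ p-bij T) refl

    cDes-pIter : ∀ m T i → rotate m i ∈ cDes (pIter m T) ⇔ i ∈ cDes T
    cDes-pIter zero    T i = ⇔-id _
    cDes-pIter (suc m) T i = cDes-pIter m T i ⇔-∘ rotates (pIter m T) (rotate m i)

  module CutSums (la mu : List ℕ) (E : CyclicExtension la mu) (α : List ℕ) where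
    open CyclicExtension E
    open Iterates E

    N : ℕ
    N = size la mu

    linearCount : SYT la mu → ℕ
    linearCount T = length (filter (ascending? (cDes T)) (Words α N))

    -- For a fixed cut k, reindexing the tableaux by T ↦ p^k(T) and rotating words by k
    -- turns every cyclic count into a linear count.
    cut-independent : ∀ k → sum (map (λ T → cyclicCount α (cDes T) k) (allSYT la mu)) ≡ sum (map linearCount (allSYT la mu))
    cut-independent k = trans
      (sym (sum-reindex (allSYT-unique la mu) (pIter m) (pIter-injective m) (λ _ → allSYT-complete la mu _)
        (λ {T} _ → let (S , pIterS≡T) = pIter-surjective m T in S , allSYT-complete la mu S , pIterS≡T)
        (λ T → cyclicCount α (cDes T) k)))
      (cong sum (map-cong (λ T → Rotation.rotation-count k (cDes T) (cDes (pIter m T)) (cDes-pIter m T) α) (allSYT la mu)))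
      where
      m : ℕ
      m = toℕ k

open Counting using (sum-swap; sum-map-const)
open GesselLemma using (module Fundamental)
open CyclicCounting using (cyclicCount; Fcyc-by-cut; module CutSums)
open import Data.Nat using (_*_)
open import Data.Nat.ListAction using (sum)
open import Data.List using (length; allFin)
open import Data.List.Properties using (length-tabulate; map-∘; map-cong)
open import Relation.Binary.PropositionalEquality using (sym; cong; cong₂; module ≡-Reasoning)

theorem4p6 : (la mu : List ℕ) → IsPartition la → IsPartition mu → mu ⊆ₚ la →
    ¬ IsConnectedRibbon la mu → (E : CyclicExtension la mu) →
    (size la mu ·ˢ skewSchur la mu) ≈ˢ
      sumˢ (map (λ T → Fcyc (size la mu) (CyclicExtension.cDes E T)) (allSYT la mu))
theorem4p6 la mu pla pmu sub _ E α = sym (begin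
  sum (map (λ f → f α) (map (λ T → Fcyc N (cDes T)) SYTs))
    ≡⟨ cong sum (sym (map-∘ SYTs)) ⟩
  sum (map (λ T → Fcyc N (cDes T) α) SYTs)
    ≡⟨ cong sum (map-cong (λ T → Fcyc-by-cut N (cDes T) α) SYTs) ⟩
  sum (map (λ T → sum (map (cyclicCount α (cDes T)) (allFin N))) SYTs)
    ≡⟨ sum-swap (λ T k → cyclicCount α (cDes T) k) SYTs (allFin N) ⟩
  sum (map (λ k → sum (map (λ T → cyclicCount α (cDes T) k) SYTs)) (allFin N))
    ≡⟨ cong sum (map-cong cut-independent (allFin N)) ⟩
  sum (map (λ _ → sum (map linearCount SYTs)) (allFin N))
    ≡⟨ sum-map-const _ (allFin N) ⟩
  length (allFin N) * sum (map linearCount SYTs)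
    ≡⟨ cong₂ _*_ (length-tabulate {n = N} (λ i → i)) (Fundamental.fundamental la mu pla pmu sub cDes extends α) ⟩
  N * skewSchur la mu α ∎)
  where
  open ≡-Reasoning
  open CyclicExtension E
  open CutSums la mu E α
  SYTs : List (SYT la mu)
  SYTs = allSYT la mu
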